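{- Let $k\geq 2$ be an integer, $G$ a finite connected simple graph, $v\in V(G)$, $\mathcal{L}_{v,G}$ the set of all leaves of $G$ adjacent to $v$, and $r=|\mathcal{L}_{v,G}|$. (1) If $r\geq 2$, then there exists a $\gamma_k(G)$-function $f$ with $f(v)=k$ and $f(u)=0$ for every leaf $u$ adjacent to $v$; likewise there exists a $\gamma_k^s(G)$-function $f$ with $f(v)=k$ and $f(u)=0$ for every leaf $u$ adjacent to $v$. (2) If $r\geq 2$ and $H$ is a graph obtained from $G$ by attaching some pendant edges to $v$, then $\gamma_k(H)=\gamma_k(G)$ and $\gamma_k^s(H)=\gamma_k^s(G)$.
   Context: A leaf is a vertex of degree 1. For $f:V(G)\to\{0,1,\dots,k\}$ let $w(f)=\sum_v f(v)$. $f$ is a Roman $k$-dominating function ($k$-RDF) if every $u$ with $f(u)<k/2$ satisfies $\sum_{x\in N_G[u]}f(x)\geq k$ (closed neighbourhood); it is a strong Roman $k$-dominating function ($k$-SRDF) if every $u$ with $f(u)<k/2$ satisfies $f(u)+\sum_{x\in N_G(u),\, f(x)>k/2}f(x)\geq k$ (open neighbourhood). $\gamma_k(G)$ (resp. $\gamma_k^s(G)$) is the minimum weight of a $k$-RDF (resp. $k$-SRDF); a $\gamma_k(G)$-function (resp. $\gamma_k^s(G)$-function) is a $k$-RDF (resp. $k$-SRDF) of that minimum weight. -}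

module Defs where

open import Data.Nat using (ℕ; zero; suc; _+_; _*_; _≤_; _<_; _<ᵇ_; _≡ᵇ_)
open import Data.Bool using (Bool; true; false; if_then_else_; _∧_; _∨_)
open import Data.Fin using (Fin; _≟_; _↑ˡ_; _↑ʳ_)
open import Data.List using (List; map; allFin)
open import Data.Nat.ListAction using (sum)
open import Data.Product using (Σ; _×_; _,_)
open import Relation.Binary.PropositionalEquality using (_≡_)
open import Relation.Nullary.Decidable using (⌊_⌋)

record Graph (n : ℕ) : Set where
  field
    adj   : Fin n → Fin n → Bool
    sym   : ∀ x y → adj x y ≡ adj y x
    irr   : ∀ x → adj x x ≡ false
open Graph public

Σᵥ : {n : ℕ} → (Fin n → ℕ) → ℕ
Σᵥ {n} g = sum (map g (allFin n))

data Walk {n : ℕ} (G : Graph n) : Fin n → Fin n → Set where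
  here : ∀ x → Walk G x x
  step : ∀ x y z → adj G x y ≡ true → Walk G y z → Walk G x z

Connected : {n : ℕ} → Graph n → Set
Connected G = ∀ x y → Walk G x y

degree : {n : ℕ} → Graph n → Fin n → ℕ
degree G u = Σᵥ (λ x → if adj G u x then 1 else 0)

IsLeaf : {n : ℕ} → Graph n → Fin n → Set
IsLeaf G u = degree G u ≡ 1

numLeavesAt : {n : ℕ} → Graph n → Fin n → ℕ
numLeavesAt G v = Σᵥ (λ x → if adj G v x ∧ (degree G x ≡ᵇ 1) then 1 else 0)

weight : {n : ℕ} → (Fin n → ℕ) → ℕ
weight f = Σᵥ f

closedSum : {n : ℕ} → Graph n → (Fin n → ℕ) → Fin n → ℕ
closedSum G f u = Σᵥ (λ x → if adj G u x ∨ ⌊ u ≟ x ⌋ then f x else 0)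

-- Σ_{x ∈ N(u), f x > k/2} f x   (f x > k/2  ⇔  k < 2 * f x)
strongSum : {n : ℕ} → Graph n → ℕ → (Fin n → ℕ) → Fin n → ℕ
strongSum G k f u = Σᵥ (λ x → if adj G u x ∧ (k <ᵇ 2 * f x) then f x else 0)

-- f : V → {0,…,k};  f u < k/2  ⇔  2 * f u < k
IsRDF : {n : ℕ} → Graph n → ℕ → (Fin n → ℕ) → Set
IsRDF G k f = (∀ x → f x ≤ k) × (∀ u → 2 * f u < k → k ≤ closedSum G f u)

IsSRDF : {n : ℕ} → Graph n → ℕ → (Fin n → ℕ) → Set
IsSRDF G k f = (∀ x → f x ≤ k) × (∀ u → 2 * f u < k → k ≤ f u + strongSum G k f u)

IsGammaFun : {n : ℕ} → Graph n → ℕ → (Fin n → ℕ) → Set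
IsGammaFun G k f = IsRDF G k f × (∀ g → IsRDF G k g → weight f ≤ weight g)

IsGammaSFun : {n : ℕ} → Graph n → ℕ → (Fin n → ℕ) → Set
IsGammaSFun G k f = IsSRDF G k f × (∀ g → IsSRDF G k g → weight f ≤ weight g)

IsGamma : {n : ℕ} → Graph n → ℕ → ℕ → Set
IsGamma G k m = Σ (Fin _ → ℕ) (λ f → IsGammaFun G k f × weight f ≡ m)

IsGammaS : {n : ℕ} → Graph n → ℕ → ℕ → Set
IsGammaS G k m = Σ (Fin _ → ℕ) (λ f → IsGammaSFun G k f × weight f ≡ m)

-- H (on Fin (n + m)) is obtained from G (on Fin n) by attaching m pendant
-- edges to v: old vertices are x ↑ˡ m, new ones n ↑ʳ j; G is the
-- subgraph induced on old vertices, each new vertex is adjacent exactly to v.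
AttachPendants : {n : ℕ} (m : ℕ) → Graph n → Fin n → Graph (n + m) → Set
AttachPendants {n} m G v H =
  (∀ x y → adj H (x ↑ˡ m) (y ↑ˡ m) ≡ adj G x y) ×
  (∀ j x → adj H (n ↑ʳ j) (x ↑ˡ m) ≡ ⌊ x ≟ v ⌋) ×
  (∀ i j → adj H (n ↑ʳ i) (n ↑ʳ j) ≡ false)

-- Let a, b be two leaves at v. In a (strong) Roman k-dominating function f, a leaf p with
-- f p < k/2 can only be dominated through v, so f p + f v ≥ k; using both leaves,
-- f a + f b + f v ≥ k. Hence concentrating f (value k at v, 0 on every vertex whose only
-- neighbour is v, unchanged elsewhere) does not increase the weight, and the result is still
-- dominating since those pendant vertices neighbour nothing but v. For (2), a
-- concentrated function on G extends by 0 to the new pendant vertices, and a concentrated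
-- function on H restricts to G, both keeping the weight.
module Submission where

open import Defs hiding (sym)
open import Data.Nat using (ℕ; zero; suc; _+_; _*_; _≤_; _<_; _<ᵇ_; _≡ᵇ_; z≤n; s≤s; _≤?_; _<?_)
open import Data.Nat.Properties hiding (_≟_)
open import Data.Bool using (Bool; true; false; if_then_else_; _∧_; _∨_; T)
open import Data.Bool.Properties using (T-≡) renaming (_≟_ to _≟ᵇ_)
open import Data.Fin using (Fin; zero; suc; toℕ; fromℕ<; _≟_; _↑ˡ_; _↑ʳ_; splitAt; punchIn; punchOut)
open import Data.Fin.Properties
  using (any?; all?; splitAt-↑ˡ; splitAt-↑ʳ; splitAt⁻¹-↑ˡ; splitAt⁻¹-↑ʳ; toℕ≤pred[n]; toℕ-fromℕ<;
         punchInᵢ≢i; punchIn-punchOut)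
open import Data.Vec.Functional using (_∷_; _++_)
open import Data.Vec.Functional.Properties using (lookup-++ˡ; lookup-++ʳ)
open import Data.Sum using (inj₁; inj₂)
open import Data.Nat.Induction using (<-wellFounded)
open import Induction.WellFounded using (Acc; acc)
open import Data.List using (tabulate)
open import Data.List.Properties using (map-tabulate)
import Data.Nat.ListAction as List
open import Data.Product using (Σ; ∃; ∃₂; _×_; _,_; proj₁; proj₂; map₁; map₂)
open import Function.Bundles using (_⇔_; mk⇔; Equivalence)
open import Function using (_∘_; id)
open import Relation.Binary.PropositionalEquality
open import Relation.Nullary using (Dec; yes; no; ¬_; contradiction)
open import Relation.Nullary.Reflects using (ofʸ; ofⁿ)
open import Relation.Nullary.Decidable using (⌊_⌋; toWitness; map′; _×-dec_; _→-dec_)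
open import Algebra.Properties.CommutativeMonoid.Sum +-0-commutativeMonoid
  using (sum; sum-cong-≗; sum-remove; ∑-distrib-+; sum-replicate-zero)

Σᵥ≡sum : ∀ {n} (g : Fin n → ℕ) → Σᵥ g ≡ sum g
Σᵥ≡sum g = trans (cong List.sum (map-tabulate id g)) (sum-tabulate g)
  where
  sum-tabulate : ∀ {n} (g : Fin n → ℕ) → List.sum (tabulate g) ≡ sum g
  sum-tabulate {zero} g = refl
  sum-tabulate {suc n} g = cong (g zero +_) (sum-tabulate (g ∘ suc))

sum-mono-≤ : ∀ {n} {f g : Fin n → ℕ} → (∀ x → f x ≤ g x) → sum f ≤ sum g
sum-mono-≤ {zero} f≤g = z≤n
sum-mono-≤ {suc n} f≤g = +-mono-≤ (f≤g zero) (sum-mono-≤ (f≤g ∘ suc))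

term≤sum : ∀ {n} (f : Fin n → ℕ) a → f a ≤ sum f
term≤sum {suc n} f a = ≤-trans (m≤m+n (f a) _) (≤-reflexive (sym (sum-remove {i = a} f)))

two-terms≤sum : ∀ {n} (f : Fin n → ℕ) {a b} → a ≢ b → f a + f b ≤ sum f
two-terms≤sum {suc n} f {a} {b} a≢b = begin
  f a + f b                          ≡⟨ cong (λ y → f a + f y) (punchIn-punchOut a≢b) ⟨
  f a + f (punchIn a (punchOut a≢b)) ≤⟨ +-monoʳ-≤ (f a) (term≤sum (f ∘ punchIn a) (punchOut a≢b)) ⟩
  f a + sum (f ∘ punchIn a)          ≡⟨ sum-remove {i = a} f ⟨
  sum f                              ∎
  where open ≤-Reasoning

sum-supported : ∀ {n} (f : Fin n → ℕ) a → (∀ x → x ≢ a → f x ≡ 0) → sum f ≡ f a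
sum-supported {suc n} f a f≡0 = begin
  sum f                     ≡⟨ sum-remove {i = a} f ⟩
  f a + sum (f ∘ punchIn a) ≡⟨ cong (f a +_) (sum-cong-≗ (λ i → f≡0 _ (punchInᵢ≢i a i))) ⟩
  f a + sum {n} (λ _ → 0)   ≡⟨ cong (f a +_) (sum-replicate-zero n) ⟩
  f a + 0                   ≡⟨ +-identityʳ (f a) ⟩
  f a                       ∎
  where open ≡-Reasoning

sum-single : ∀ {n} a (g : Fin n → ℕ) → sum (λ x → if ⌊ x ≟ a ⌋ then g x else 0) ≡ g a
sum-single a g = trans (sum-supported _ a vanishes) at-a
  where
  vanishes : ∀ x → x ≢ a → (if ⌊ x ≟ a ⌋ then g x else 0) ≡ 0
  vanishes x x≢a with x ≟ a
  ... | yes x≡a = contradiction x≡a x≢a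
  ... | no _    = refl
  at-a : (if ⌊ a ≟ a ⌋ then g a else 0) ≡ g a
  at-a with a ≟ a
  ... | yes _   = refl
  ... | no a≢a = contradiction refl a≢a

sum-↑ : ∀ n {m} (f : Fin (n + m) → ℕ) → sum f ≡ sum (f ∘ (_↑ˡ m)) + sum (f ∘ (n ↑ʳ_))
sum-↑ zero    f = refl
sum-↑ (suc n) f = trans (cong (f zero +_) (sum-↑ n (f ∘ suc))) (sym (+-assoc (f zero) _ _))

positive-term : ∀ {n} (f : Fin n → ℕ) → 0 < sum f → ∃ λ a → 0 < f a
positive-term {n} f 0<sum with any? (λ x → 0 <? f x)
... | yes found = found
... | no none = contradiction 0<sum (≤⇒≯ (begin
  sum f              ≤⟨ sum-mono-≤ (λ x → ≮⇒≥ (λ 0<fx → none (x , 0<fx))) ⟩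
  sum {n} (λ _ → 0)  ≡⟨ sum-replicate-zero n ⟩
  0                  ∎))
  where open ≤-Reasoning

two-positive-terms : ∀ {n} (f : Fin n → ℕ) → (∀ x → f x ≤ 1) → 2 ≤ sum f →
  ∃₂ λ a b → a ≢ b × 0 < f a × 0 < f b
two-positive-terms {suc n} f f≤1 2≤sum with positive-term f (≤-trans (s≤s z≤n) 2≤sum)
... | a , 0<fa with positive-term (f ∘ punchIn a) rest-positive
  where
  rest-positive : 0 < sum (f ∘ punchIn a)
  rest-positive = +-cancelˡ-≤ 1 _ _ (begin
    2                         ≤⟨ 2≤sum ⟩
    sum f                     ≡⟨ sum-remove {i = a} f ⟩
    f a + sum (f ∘ punchIn a) ≤⟨ +-monoˡ-≤ _ (f≤1 a) ⟩
    1 + sum (f ∘ punchIn a)   ∎)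
    where open ≤-Reasoning
... | i , 0<fb = a , punchIn a i , punchInᵢ≢i a i ∘ sym , 0<fa , 0<fb

weight-cong : ∀ {n} {f g : Fin n → ℕ} → f ≗ g → weight f ≡ weight g
weight-cong {f = f} {g} f≗g = begin
  weight f ≡⟨ Σᵥ≡sum f ⟩
  sum f    ≡⟨ sum-cong-≗ f≗g ⟩
  sum g    ≡⟨ Σᵥ≡sum g ⟨
  weight g ∎
  where open ≡-Reasoning

2k≮k : ∀ k → ¬ 2 * k < k
2k≮k k 2k<k = <⇒≱ 2k<k (m≤m+n k _)

threshold-split : ∀ {k a b z} → (2 * a < k → k ≤ a + z) → (2 * b < k → k ≤ b + z) → k ≤ a + b + z
threshold-split {k} {a} {b} {z} bound-a bound-b with 2 * a <? k | 2 * b <? k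
... | yes 2a<k | _        = ≤-trans (bound-a 2a<k) (+-monoˡ-≤ z (m≤m+n a b))
... | no _     | yes 2b<k = ≤-trans (bound-b 2b<k) (+-monoˡ-≤ z (m≤n+m b a))
... | no 2a≮k  | no 2b≮k  = ≤-trans k≤a+b (m≤m+n (a + b) z)
  where
  open ≤-Reasoning
  k≤a+b : k ≤ a + b
  k≤a+b = *-cancelˡ-≤ 2 (begin
    2 * k         ≡⟨ cong (k +_) (+-identityʳ k) ⟩
    k + k         ≤⟨ +-mono-≤ (≮⇒≥ 2a≮k) (≮⇒≥ 2b≮k) ⟩
    2 * a + 2 * b ≡⟨ *-distribˡ-+ 2 a b ⟨
    2 * (a + b)   ∎)

Bounded : ∀ {n} → ℕ → (Fin n → ℕ) → Set
Bounded k f = ∀ x → f x ≤ k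

Congruent : ∀ {n} → ((Fin n → ℕ) → Set) → Set
Congruent P = ∀ {f g} → f ≗ g → P f → P g

Minimal : ∀ {n} → ((Fin n → ℕ) → Set) → (Fin n → ℕ) → Set
Minimal P f = P f × (∀ g → P g → weight f ≤ weight g)

Minimal-⇔ : ∀ {n} {P Q : (Fin n → ℕ) → Set} → (∀ f → P f ⇔ Q f) → ∀ f → Minimal P f ⇔ Minimal Q f
Minimal-⇔ P⇔Q f = mk⇔
  (λ (p , least) → to (P⇔Q f) p , λ g q → least g (from (P⇔Q g) q))
  (λ (q , least) → from (P⇔Q f) q , λ g p → least g (to (P⇔Q g) p))
  where open Equivalence

∃-bounded? : ∀ n k {P : (Fin n → ℕ) → Set} → Congruent P → (∀ f → Dec (P f)) →
  Dec (∃ λ f → Bounded k f × P f)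
∃-bounded? zero k P-cong P? with P? (λ ())
... | yes p = yes ((λ ()) , (λ ()) , p)
... | no ¬p = no λ (_ , _ , p) → ¬p (P-cong (λ ()) p)
∃-bounded? (suc n) k {P} P-cong P? =
  map′ cons uncons (any? λ (a : Fin (suc k)) →
    ∃-bounded? n k (P-cong ∘ ∷-cong) (λ g → P? (toℕ a ∷ g)))
  where
  ∷-cong : ∀ {a} {g h : Fin n → ℕ} → g ≗ h → (a ∷ g) ≗ (a ∷ h)
  ∷-cong g≗h zero    = refl
  ∷-cong g≗h (suc x) = g≗h x
  cons : (∃ λ a → ∃ λ g → Bounded k g × P (toℕ a ∷ g)) → ∃ λ f → Bounded k f × P f
  cons (a , g , g≤k , p) = toℕ a ∷ g , (λ { zero → toℕ≤pred[n] a ; (suc x) → g≤k x }) , p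
  uncons : (∃ λ f → Bounded k f × P f) → ∃ λ a → ∃ λ g → Bounded k g × P (toℕ a ∷ g)
  uncons (f , f≤k , p) = fromℕ< (s≤s (f≤k zero)) , f ∘ suc , f≤k ∘ suc ,
    P-cong (λ { zero → sym (toℕ-fromℕ< _) ; (suc x) → refl }) p

minimal-exists : ∀ {n} k {P : (Fin n → ℕ) → Set} → Congruent P → (∀ f → Dec (P f)) →
  (∀ {f} → P f → Bounded k f) → ∀ {f} → P f → ∃ (Minimal P)
minimal-exists {n} k {P} P-cong P? bounded p = descend p (<-wellFounded _)
  where
  descend : ∀ {f} → P f → Acc _<_ (weight f) → ∃ (Minimal P)
  descend {f} p (acc smaller)
    with ∃-bounded? n k (λ g≗h (p , <f) → P-cong g≗h p , subst (_< weight f) (weight-cong g≗h) <f)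
                        (λ g → P? g ×-dec (weight g <? weight f))
  ... | yes (g , _ , q , g<f) = descend q (smaller g<f)
  ... | no none = f , p , λ g q → ≮⇒≥ λ g<f → none (g , bounded q , q , g<f)

PendantAt : ∀ {n} → Graph n → Fin n → Fin n → Set
PendantAt G v p = adj G p v ≡ true × (∀ y → adj G p y ≡ true → y ≡ v)

pendant? : ∀ {n} (G : Graph n) v p → Dec (PendantAt G v p)
pendant? G v p = (adj G p v ≟ᵇ true) ×-dec all? (λ y → (adj G p y ≟ᵇ true) →-dec (y ≟ v))

pendant≢centre : ∀ {n} (G : Graph n) {v p} → PendantAt G v p → p ≢ v
pendant≢centre G (p~v , _) refl with trans (sym (irr G _)) p~v
... | ()

leaf⇒pendant : ∀ {n} (G : Graph n) {v u} → adj G v u ≡ true → IsLeaf G u → PendantAt G v u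
leaf⇒pendant G {v} {u} v~u leaf = u~v , only-v
  where
  indicator : Bool → ℕ
  indicator b = if b then 1 else 0
  u~v : adj G u v ≡ true
  u~v = trans (Graph.sym G u v) v~u
  only-v : ∀ y → adj G u y ≡ true → y ≡ v
  only-v y u~y with y ≟ v
  ... | yes y≡v = y≡v
  ... | no y≢v = contradiction (begin
    2                                             ≡⟨ cong₂ _+_ (cong indicator u~v) (cong indicator u~y) ⟨
    indicator (adj G u v) + indicator (adj G u y) ≤⟨ two-terms≤sum (indicator ∘ adj G u) (y≢v ∘ sym) ⟩
    sum (indicator ∘ adj G u)                     ≡⟨ Σᵥ≡sum (indicator ∘ adj G u) ⟨
    degree G u                                    ≡⟨ leaf ⟩
    1                                             ∎) (<⇒≱ (s≤s ≤-refl))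
    where open ≤-Reasoning

two-leaves : ∀ {n} (G : Graph n) v → 2 ≤ numLeavesAt G v →
  ∃₂ λ a b → a ≢ b × PendantAt G v a × PendantAt G v b
two-leaves G v 2≤leaves
  with two-positive-terms leafIndicator (λ x → ≤1 (adj G v x ∧ (degree G x ≡ᵇ 1)))
                          (subst (2 ≤_) (Σᵥ≡sum leafIndicator) 2≤leaves)
  where
  leafIndicator : _ → ℕ
  leafIndicator x = if adj G v x ∧ (degree G x ≡ᵇ 1) then 1 else 0
  ≤1 : ∀ b → (if b then 1 else 0) ≤ 1
  ≤1 true  = ≤-refl
  ≤1 false = z≤n
... | a , b , a≢b , leaf-a , leaf-b = a , b , a≢b , pendant leaf-a , pendant leaf-b
  where
  pendant : ∀ {x} → 0 < (if adj G v x ∧ (degree G x ≡ᵇ 1) then 1 else 0) → PendantAt G v x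
  pendant {x} positive with adj G v x in v~x | degree G x ≡ᵇ 1 in deg≡1
  ... | true | true = leaf⇒pendant G v~x (≡ᵇ⇒≡ (degree G x) 1 (subst T (sym deg≡1) _))

neighbourSum : ∀ {n} → Graph n → Fin n → (Fin n → ℕ) → ℕ
neighbourSum G u g = sum (λ x → if adj G u x then g x else 0)

neighbourSum-cong : ∀ {n} (G : Graph n) u {g h : Fin n → ℕ} → g ≗ h →
  neighbourSum G u g ≡ neighbourSum G u h
neighbourSum-cong G u g≗h = sum-cong-≗ λ x → cong (λ t → if adj G u x then t else 0) (g≗h x)

neighbourSum-mono : ∀ {n} (G : Graph n) u {g h : Fin n → ℕ} →
  (∀ x → adj G u x ≡ true → g x ≤ h x) → neighbourSum G u g ≤ neighbourSum G u h
neighbourSum-mono G u g≤h = sum-mono-≤ pointwise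
  where
  pointwise : ∀ x → (if adj G u x then _ else 0) ≤ (if adj G u x then _ else 0)
  pointwise x with adj G u x in u~x
  ... | true  = g≤h x u~x
  ... | false = z≤n

term≤neighbourSum : ∀ {n} (G : Graph n) {u x} (g : Fin n → ℕ) → adj G u x ≡ true →
  g x ≤ neighbourSum G u g
term≤neighbourSum G {u} {x} g u~x =
  subst (_≤ neighbourSum G u g) (cong (λ b → if b then g x else 0) u~x)
        (term≤sum (λ y → if adj G u y then g y else 0) x)

neighbourSum-pendant : ∀ {n} (G : Graph n) {v p} → PendantAt G v p → ∀ g →
  neighbourSum G p g ≡ g v
neighbourSum-pendant G {v} {p} (p~v , only-v) g =
  trans (sum-supported _ v vanishes) (cong (λ b → if b then g v else 0) p~v)
  where
  vanishes : ∀ x → x ≢ v → (if adj G p x then g x else 0) ≡ 0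
  vanishes x x≢v with adj G p x in p~x
  ... | true  = contradiction (only-v x p~x) x≢v
  ... | false = refl

closedSum≡ : ∀ {n} (G : Graph n) f u → closedSum G f u ≡ f u + neighbourSum G u f
closedSum≡ G f u = begin
  closedSum G f u                  ≡⟨ Σᵥ≡sum closed ⟩
  sum closed                       ≡⟨ sum-cong-≗ pointwise ⟩
  sum (λ x → self x + neighbour x) ≡⟨ ∑-distrib-+ self neighbour ⟩
  sum self + neighbourSum G u f    ≡⟨ cong (_+ neighbourSum G u f) (sum-supported self u self-only) ⟩
  self u + neighbourSum G u f      ≡⟨ cong (_+ neighbourSum G u f) self-at-u ⟩
  f u + neighbourSum G u f         ∎
  where
  open ≡-Reasoning
  closed self neighbour : _ → ℕ
  closed x = if adj G u x ∨ ⌊ u ≟ x ⌋ then f x else 0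
  self x = if ⌊ u ≟ x ⌋ then f x else 0
  neighbour x = if adj G u x then f x else 0
  self-only : ∀ x → x ≢ u → self x ≡ 0
  self-only x x≢u with u ≟ x
  ... | yes u≡x = contradiction (sym u≡x) x≢u
  ... | no _    = refl
  self-at-u : self u ≡ f u
  self-at-u with u ≟ u
  ... | yes _   = refl
  ... | no u≢u = contradiction refl u≢u
  pointwise : ∀ x → closed x ≡ self x + neighbour x
  pointwise x with u ≟ x
  ... | yes refl rewrite irr G u = sym (+-identityʳ (f u))
  ... | no _ with adj G u x
  ...   | true  = refl
  ...   | false = refl

heavyPart : ℕ → ℕ → ℕ
heavyPart k t = if k <ᵇ 2 * t then t else 0

strongSum≡ : ∀ {n} (G : Graph n) k f u → strongSum G k f u ≡ neighbourSum G u (heavyPart k ∘ f)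
strongSum≡ G k f u = trans (Σᵥ≡sum strong) (sum-cong-≗ pointwise)
  where
  strong : _ → ℕ
  strong x = if adj G u x ∧ (k <ᵇ 2 * f x) then f x else 0
  pointwise : ∀ x → strong x ≡ (if adj G u x then heavyPart k (f x) else 0)
  pointwise x with adj G u x
  ... | true  = refl
  ... | false = refl

-- What a neighbour labelled t contributes towards dominating a vertex: all of t for Roman
-- domination (full), and t only when t > k/2 for strong Roman domination (heavy).
record Contribution (k : ℕ) : Set where
  field
    c      : ℕ → ℕ
    c-mono : ∀ {s t} → s ≤ t → c s ≤ c t
    c≤id   : ∀ t → c t ≤ t
    k≤c[k] : k ≤ c k

IsDominating : ∀ {n} → (ℕ → ℕ) → Graph n → ℕ → (Fin n → ℕ) → Set
IsDominating c G k f = Bounded k f × (∀ u → 2 * f u < k → k ≤ f u + neighbourSum G u (c ∘ f))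

full : ∀ k → Contribution k
full k = record { c = id ; c-mono = id ; c≤id = λ _ → ≤-refl ; k≤c[k] = ≤-refl }

heavy : ∀ {k} → 1 ≤ k → Contribution k
heavy {k} 1≤k = record
  { c = heavyPart k ; c-mono = mono ; c≤id = deflationary ; k≤c[k] = heavy-at-k }
  where
  mono : ∀ {s t} → s ≤ t → heavyPart k s ≤ heavyPart k t
  mono {s} {t} s≤t with k <ᵇ 2 * s | <ᵇ-reflects-< k (2 * s) | k <ᵇ 2 * t | <ᵇ-reflects-< k (2 * t)
  ... | false | _        | _     | _        = z≤n
  ... | true  | _        | true  | _        = s≤t
  ... | true  | ofʸ k<2s | false | ofⁿ k≮2t = contradiction (<-≤-trans k<2s (*-monoʳ-≤ 2 s≤t)) k≮2t
  deflationary : ∀ t → heavyPart k t ≤ t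
  deflationary t with k <ᵇ 2 * t
  ... | true  = ≤-refl
  ... | false = z≤n
  heavy-at-k : k ≤ heavyPart k k
  heavy-at-k with k <ᵇ 2 * k | <ᵇ-reflects-< k (2 * k)
  ... | true  | _        = ≤-refl
  ... | false | ofⁿ k≮2k = contradiction (m<m+n k (≤-trans 1≤k (m≤m+n k 0))) k≮2k

IsRDF⇔IsDominating : ∀ {n} (G : Graph n) k f → IsRDF G k f ⇔ IsDominating id G k f
IsRDF⇔IsDominating G k f = mk⇔
  (map₂ λ dominated u 2fu<k → subst (k ≤_) (closedSum≡ G f u) (dominated u 2fu<k))
  (map₂ λ dominated u 2fu<k → subst (k ≤_) (sym (closedSum≡ G f u)) (dominated u 2fu<k))

IsSRDF⇔IsDominating : ∀ {n} (G : Graph n) k f → IsSRDF G k f ⇔ IsDominating (heavyPart k) G k f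
IsSRDF⇔IsDominating G k f = mk⇔
  (map₂ λ dominated u 2fu<k → subst (λ s → k ≤ f u + s) (strongSum≡ G k f u) (dominated u 2fu<k))
  (map₂ λ dominated u 2fu<k → subst (λ s → k ≤ f u + s) (sym (strongSum≡ G k f u)) (dominated u 2fu<k))

isDominating? : ∀ {n} c (G : Graph n) k f → Dec (IsDominating c G k f)
isDominating? c G k f =
  all? (λ x → f x ≤? k) ×-dec
  all? (λ u → (2 * f u <? k) →-dec (k ≤? f u + neighbourSum G u (c ∘ f)))

isDominating-cong : ∀ {n} c (G : Graph n) k → Congruent (IsDominating c G k)
isDominating-cong c G k {f} {g} f≗g (f≤k , dominated) =
  (λ x → subst (_≤ k) (f≗g x) (f≤k x)) ,
  λ u 2gu<k → subst (k ≤_) (cong₂ _+_ (f≗g u) (neighbourSum-cong G u (cong c ∘ f≗g)))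
                   (dominated u (subst (λ t → 2 * t < k) (sym (f≗g u)) 2gu<k))

minimal-dominating-exists : ∀ {n} c (G : Graph n) k → ∃ (Minimal (IsDominating c G k))
minimal-dominating-exists c G k =
  minimal-exists k (isDominating-cong c G k) (isDominating? c G k) proj₁
    {f = λ _ → k} ((λ _ → ≤-refl) , λ _ 2k<k → contradiction 2k<k (2k≮k k))

concentrate : ∀ {n} → Graph n → Fin n → ℕ → (Fin n → ℕ) → Fin n → ℕ
concentrate G v k f x = if ⌊ x ≟ v ⌋ then k else if ⌊ pendant? G v x ⌋ then 0 else f x

concentrate-centre : ∀ {n} (G : Graph n) v k f → concentrate G v k f v ≡ k
concentrate-centre G v k f with v ≟ v
... | yes _   = refl
... | no v≢v = contradiction refl v≢v

concentrate-pendant : ∀ {n} (G : Graph n) {v p} k f → PendantAt G v p → concentrate G v k f p ≡ 0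
concentrate-pendant G {v} {p} k f pendant with p ≟ v | pendant? G v p
... | yes p≡v | _           = contradiction p≡v (pendant≢centre G pendant)
... | no _    | yes _       = refl
... | no _    | no ¬pendant = contradiction pendant ¬pendant

pendantPart : ∀ {n} → Graph n → Fin n → (Fin n → ℕ) → Fin n → ℕ
pendantPart G v f x = if ⌊ pendant? G v x ⌋ then f x else 0

pendantPart-pendant : ∀ {n} (G : Graph n) {v p} f → PendantAt G v p → pendantPart G v f p ≡ f p
pendantPart-pendant G {v} {p} f pendant with pendant? G v p
... | yes _       = refl
... | no ¬pendant = contradiction pendant ¬pendant

concentrate-weight : ∀ {n} (G : Graph n) v k f →
  weight (concentrate G v k f) + (f v + sum (pendantPart G v f)) ≡ weight f + k
concentrate-weight {n} G v k f = begin
  weight F + (f v + sum P)               ≡⟨ cong₂ (λ s t → s + (t + sum P)) (Σᵥ≡sum F) (sym (sum-single v f)) ⟩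
  sum F + (sum (atCentre f) + sum P)     ≡⟨ cong (sum F +_) (∑-distrib-+ (atCentre f) P) ⟨
  sum F + sum (λ x → atCentre f x + P x) ≡⟨ ∑-distrib-+ F _ ⟨
  sum (λ x → F x + (atCentre f x + P x)) ≡⟨ sum-cong-≗ pointwise ⟩
  sum (λ x → f x + atCentre (λ _ → k) x) ≡⟨ ∑-distrib-+ f _ ⟩
  sum f + sum (atCentre (λ _ → k))       ≡⟨ cong₂ _+_ (sym (Σᵥ≡sum f)) (sum-single v (λ _ → k)) ⟩
  weight f + k                           ∎
  where
  open ≡-Reasoning
  F P : Fin n → ℕ
  F = concentrate G v k f
  P = pendantPart G v f
  atCentre : (Fin n → ℕ) → Fin n → ℕ
  atCentre g x = if ⌊ x ≟ v ⌋ then g x else 0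
  pointwise : ∀ x → F x + (atCentre f x + P x) ≡ f x + atCentre (λ _ → k) x
  pointwise x with x ≟ v | pendant? G v x
  ... | yes refl | yes pendant = contradiction refl (pendant≢centre G pendant)
  ... | yes refl | no _        = trans (cong (k +_) (+-identityʳ (f x))) (+-comm k (f x))
  ... | no _     | yes _       = sym (+-identityʳ (f x))
  ... | no _     | no _        = refl

data Side (n m : ℕ) : Fin (n + m) → Set where
  old : (x : Fin n) → Side n m (x ↑ˡ m)
  new : (j : Fin m) → Side n m (n ↑ʳ j)

side : ∀ n {m} (y : Fin (n + m)) → Side n m y
side n y with splitAt n y in eq
... | inj₁ x = subst (Side n _) (splitAt⁻¹-↑ˡ eq) (old x)
... | inj₂ j = subst (Side n _) (splitAt⁻¹-↑ʳ eq) (new j)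

↑ˡ≢↑ʳ : ∀ {n m} (x : Fin n) (j : Fin m) → x ↑ˡ m ≢ n ↑ʳ j
↑ˡ≢↑ʳ {n} {m} x j x≡j
  with trans (sym (splitAt-↑ˡ n x m)) (trans (cong (splitAt n) x≡j) (splitAt-↑ʳ n m j))
... | ()

isYes-true : ∀ {A : Set} (d : Dec A) → ⌊ d ⌋ ≡ true → A
isYes-true d = toWitness ∘ Equivalence.from T-≡

module Attached {n m} (G : Graph n) (v : Fin n) (H : Graph (n + m))
                (attach : AttachPendants m G v H) where

  private
    old~old : ∀ x y → adj H (x ↑ˡ m) (y ↑ˡ m) ≡ adj G x y
    old~old = proj₁ attach
    new~old : ∀ j x → adj H (n ↑ʳ j) (x ↑ˡ m) ≡ ⌊ x ≟ v ⌋
    new~old = proj₁ (proj₂ attach)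
    new≁new : ∀ i j → adj H (n ↑ʳ i) (n ↑ʳ j) ≡ false
    new≁new = proj₂ (proj₂ attach)
    old~new : ∀ x j → adj H (x ↑ˡ m) (n ↑ʳ j) ≡ ⌊ x ≟ v ⌋
    old~new x j = trans (Graph.sym H _ _) (new~old j x)

  extend : (Fin n → ℕ) → Fin (n + m) → ℕ
  extend f = f ++ λ _ → 0

  restrict : (Fin (n + m) → ℕ) → Fin n → ℕ
  restrict h = h ∘ (_↑ˡ m)

  neighbourSum-old : ∀ {u} → u ≢ v → ∀ g → neighbourSum H (u ↑ˡ m) g ≡ neighbourSum G u (restrict g)
  neighbourSum-old {u} u≢v g = begin
    neighbourSum H (u ↑ˡ m) g   ≡⟨ sum-↑ n _ ⟩
    sum oldPart + sum newPart   ≡⟨ cong₂ _+_ (sum-cong-≗ old-neighbours) (sum-cong-≗ no-new-neighbour) ⟩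
    S + sum {m} (λ _ → 0)       ≡⟨ cong (S +_) (sum-replicate-zero m) ⟩
    S + 0                       ≡⟨ +-identityʳ S ⟩
    S                           ∎
    where
    open ≡-Reasoning
    S : ℕ
    S = neighbourSum G u (restrict g)
    oldPart : Fin n → ℕ
    oldPart x = if adj H (u ↑ˡ m) (x ↑ˡ m) then g (x ↑ˡ m) else 0
    old-neighbours : ∀ x → oldPart x ≡ (if adj G u x then g (x ↑ˡ m) else 0)
    old-neighbours x = cong (λ b → if b then g (x ↑ˡ m) else 0) (old~old u x)
    newPart : Fin m → ℕ
    newPart j = if adj H (u ↑ˡ m) (n ↑ʳ j) then g (n ↑ʳ j) else 0
    no-new-neighbour : ∀ j → newPart j ≡ 0
    no-new-neighbour j rewrite old~new u j with u ≟ v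
    ... | yes u≡v = contradiction u≡v u≢v
    ... | no _    = refl

  new-pendant : ∀ j → PendantAt H (v ↑ˡ m) (n ↑ʳ j)
  new-pendant j = trans (new~old j v) centre , only-centre
    where
    centre : ⌊ v ≟ v ⌋ ≡ true
    centre with v ≟ v
    ... | yes _   = refl
    ... | no v≢v = contradiction refl v≢v
    only-centre : ∀ y → adj H (n ↑ʳ j) y ≡ true → y ≡ v ↑ˡ m
    only-centre y j~y with side n y
    ... | old x = cong (_↑ˡ m) (isYes-true (x ≟ v) (trans (sym (new~old j x)) j~y))
    ... | new i with trans (sym j~y) (new≁new j i)
    ...   | ()

  old-pendant : ∀ {a} → PendantAt G v a → PendantAt H (v ↑ˡ m) (a ↑ˡ m)
  old-pendant {a} pendant@(a~v , only-v) = trans (old~old a v) a~v , only-centre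
    where
    only-centre : ∀ y → adj H (a ↑ˡ m) y ≡ true → y ≡ v ↑ˡ m
    only-centre y a~y with side n y
    ... | old x = cong (_↑ˡ m) (only-v x (trans (sym (old~old a x)) a~y))
    ... | new i = contradiction (isYes-true (a ≟ v) (trans (sym (old~new a i)) a~y))
                                (pendant≢centre G pendant)

  weight-extend : ∀ f → weight (extend f) ≡ weight f
  weight-extend f = begin
    weight (extend f)                                    ≡⟨ Σᵥ≡sum (extend f) ⟩
    sum (extend f)                                       ≡⟨ sum-↑ n (extend f) ⟩
    sum (restrict (extend f)) + sum (extend f ∘ (n ↑ʳ_)) ≡⟨ cong₂ _+_ (sum-cong-≗ {n} (lookup-++ˡ f (λ _ → 0)))
                                                                     (sum-cong-≗ {m} (lookup-++ʳ f (λ _ → 0))) ⟩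
    sum f + sum {m} (λ _ → 0)                            ≡⟨ cong (sum f +_) (sum-replicate-zero m) ⟩
    sum f + 0                                            ≡⟨ +-identityʳ (sum f) ⟩
    sum f                                                ≡⟨ Σᵥ≡sum f ⟨
    weight f                                             ∎
    where open ≡-Reasoning

  weight-restrict : ∀ h → (∀ j → h (n ↑ʳ j) ≡ 0) → weight (restrict h) ≡ weight h
  weight-restrict h new≡0 = begin
    weight (restrict h)                          ≡⟨ Σᵥ≡sum (restrict h) ⟩
    sum (restrict h)                             ≡⟨ +-identityʳ _ ⟨
    sum (restrict h) + 0                         ≡⟨ cong (sum (restrict h) +_) (sum-replicate-zero m) ⟨
    sum (restrict h) + sum {m} (λ _ → 0)         ≡⟨ cong (sum (restrict h) +_) (sum-cong-≗ new≡0) ⟨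
    sum (restrict h) + sum (h ∘ (n ↑ʳ_))         ≡⟨ sum-↑ n h ⟨
    sum h                                        ≡⟨ Σᵥ≡sum h ⟨
    weight h                                     ∎
    where open ≡-Reasoning

module Domination {k : ℕ} (C : Contribution k) where
  open Contribution C

  Dominating : ∀ {n} → Graph n → (Fin n → ℕ) → Set
  Dominating G = IsDominating c G k

  pendant-bound : ∀ {n} (G : Graph n) {v p f} → Dominating G f → PendantAt G v p →
    2 * f p < k → k ≤ f p + f v
  pendant-bound G {v} {p} {f} (_ , dominated) pendant 2fp<k = begin
    k                              ≤⟨ dominated p 2fp<k ⟩
    f p + neighbourSum G p (c ∘ f) ≡⟨ cong (f p +_) (neighbourSum-pendant G pendant (c ∘ f)) ⟩
    f p + c (f v)                  ≤⟨ +-monoʳ-≤ (f p) (c≤id (f v)) ⟩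
    f p + f v                      ∎
    where open ≤-Reasoning

  concentrate-isDominating : ∀ {n} (G : Graph n) v {f} → Dominating G f →
    Dominating G (concentrate G v k f)
  concentrate-isDominating G v {f} (f≤k , dominated) = F≤k , F-dominated
    where
    F : _ → ℕ
    F = concentrate G v k f
    F≤k : Bounded k F
    F≤k x with x ≟ v | pendant? G v x
    ... | yes _ | _     = ≤-refl
    ... | no _  | yes _ = z≤n
    ... | no _  | no _  = f≤k x
    f≤F-around : ∀ {u} → u ≢ v → ∀ x → adj G u x ≡ true → f x ≤ F x
    f≤F-around {u} u≢v x u~x with x ≟ v | pendant? G v x
    ... | yes refl | _                  = f≤k x
    ... | no _     | yes (_ , only-v)   = contradiction (only-v u (trans (Graph.sym G x u) u~x)) u≢v
    ... | no _     | no _               = ≤-refl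
    F-dominated : ∀ u → 2 * F u < k → k ≤ F u + neighbourSum G u (c ∘ F)
    F-dominated u 2Fu<k with u ≟ v | pendant? G v u
    ... | yes refl | _ = contradiction 2Fu<k (2k≮k k)
    ... | no _     | yes (u~v , _) = begin
      k                           ≤⟨ k≤c[k] ⟩
      c k                         ≡⟨ cong c (concentrate-centre G v k f) ⟨
      c (F v)                     ≤⟨ term≤neighbourSum G (c ∘ F) u~v ⟩
      neighbourSum G u (c ∘ F)    ∎
      where open ≤-Reasoning
    ... | no u≢v   | no _ = ≤-trans (dominated u 2Fu<k)
      (+-monoʳ-≤ (f u) (neighbourSum-mono G u λ x u~x → c-mono (f≤F-around u≢v x u~x)))

  concentrate-improves : ∀ {n} (G : Graph n) v {f a b} → Dominating G f →
    a ≢ b → PendantAt G v a → PendantAt G v b → weight (concentrate G v k f) ≤ weight f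
  concentrate-improves G v {f} {a} {b} dominating a≢b pendant-a pendant-b =
    +-cancelʳ-≤ k _ _ (begin
      weight F + k                        ≤⟨ +-monoʳ-≤ (weight F) pendants-and-centre ⟩
      weight F + (f a + f b + f v)        ≡⟨ cong (weight F +_) (+-comm (f a + f b) (f v)) ⟩
      weight F + (f v + (f a + f b))      ≤⟨ +-monoʳ-≤ (weight F) (+-monoʳ-≤ (f v) pendant-mass) ⟩
      weight F + (f v + sum P)            ≡⟨ concentrate-weight G v k f ⟩
      weight f + k                        ∎)
    where
    open ≤-Reasoning
    F P : _ → ℕ
    F = concentrate G v k f
    P = pendantPart G v f
    pendants-and-centre : k ≤ f a + f b + f v
    pendants-and-centre = threshold-split {k} {f a} {f b} {f v}
      (pendant-bound G dominating pendant-a) (pendant-bound G dominating pendant-b)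
    pendant-mass : f a + f b ≤ sum P
    pendant-mass = subst (_≤ sum P)
      (cong₂ _+_ (pendantPart-pendant G f pendant-a) (pendantPart-pendant G f pendant-b))
      (two-terms≤sum P a≢b)

  module _ {n m} (G : Graph n) (v : Fin n) (H : Graph (n + m)) (attach : AttachPendants m G v H) where
    open Attached G v H attach

    extend-isDominating : ∀ {f} → Dominating G f → f v ≡ k → Dominating H (extend f)
    extend-isDominating {f} (f≤k , dominated) fv≡k = E≤k , E-dominated
      where
      E≤k : Bounded k (extend f)
      E≤k y with side n y
      ... | old x = subst (_≤ k) (sym (lookup-++ˡ f (λ _ → 0) x)) (f≤k x)
      ... | new j = subst (_≤ k) (sym (lookup-++ʳ f (λ _ → 0) j)) z≤n
      old-dominated : ∀ x → 2 * f x < k → k ≤ f x + neighbourSum H (x ↑ˡ m) (c ∘ extend f)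
      old-dominated x 2fx<k with x ≟ v
      ... | yes refl = contradiction (subst (λ t → 2 * t < k) fv≡k 2fx<k) (2k≮k k)
      ... | no x≢v  = subst (λ s → k ≤ f x + s)
        (sym (trans (neighbourSum-old x≢v (c ∘ extend f))
                    (neighbourSum-cong G x (cong c ∘ lookup-++ˡ f (λ _ → 0)))))
        (dominated x 2fx<k)
      new-dominated : ∀ j → k ≤ neighbourSum H (n ↑ʳ j) (c ∘ extend f)
      new-dominated j = begin
        k                                         ≤⟨ k≤c[k] ⟩
        c k                                       ≡⟨ cong c (trans (lookup-++ˡ f (λ _ → 0) v) fv≡k) ⟨
        c (extend f (v ↑ˡ m))                     ≡⟨ neighbourSum-pendant H (new-pendant j) (c ∘ extend f) ⟨
        neighbourSum H (n ↑ʳ j) (c ∘ extend f)    ∎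
        where open ≤-Reasoning
      E-dominated : ∀ y → 2 * extend f y < k → k ≤ extend f y + neighbourSum H y (c ∘ extend f)
      E-dominated y with side n y
      ... | old x = λ 2Ex<k →
        subst (λ t → k ≤ t + neighbourSum H (x ↑ˡ m) (c ∘ extend f)) (sym (lookup-++ˡ f (λ _ → 0) x))
              (old-dominated x (subst (λ t → 2 * t < k) (lookup-++ˡ f (λ _ → 0) x) 2Ex<k))
      ... | new j = λ _ → ≤-trans (new-dominated j) (m≤n+m _ (extend f (n ↑ʳ j)))

    restrict-isDominating : ∀ {h} → Dominating H h → h (v ↑ˡ m) ≡ k → Dominating G (restrict h)
    restrict-isDominating {h} (h≤k , dominated) hv≡k = h≤k ∘ (_↑ˡ m) , R-dominated
      where
      R-dominated : ∀ u → 2 * restrict h u < k → k ≤ restrict h u + neighbourSum G u (c ∘ restrict h)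
      R-dominated u 2hu<k with u ≟ v
      ... | yes refl = contradiction (subst (λ t → 2 * t < k) hv≡k 2hu<k) (2k≮k k)
      ... | no u≢v  = subst (λ s → k ≤ h (u ↑ˡ m) + s) (neighbourSum-old u≢v (c ∘ h))
                            (dominated (u ↑ˡ m) 2hu<k)

  minimal-concentrated : ∀ {n} (G : Graph n) v → 2 ≤ numLeavesAt G v →
    ∃ λ f → Minimal (Dominating G) f × f v ≡ k × (∀ u → adj G v u ≡ true → IsLeaf G u → f u ≡ 0)
  minimal-concentrated G v 2≤leaves
    with minimal-dominating-exists c G k | two-leaves G v 2≤leaves
  ... | f , dominating , least | a , b , a≢b , pendant-a , pendant-b =
    concentrate G v k f ,
    (concentrate-isDominating G v dominating ,
     λ g g-dominating → ≤-trans (concentrate-improves G v dominating a≢b pendant-a pendant-b)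
                                (least g g-dominating)) ,
    concentrate-centre G v k f ,
    λ u v~u leaf → concentrate-pendant G k f (leaf⇒pendant G v~u leaf)

  attach-preserves-minimum : ∀ {n m} (G : Graph n) v (H : Graph (n + m)) → AttachPendants m G v H →
    Fin m → 2 ≤ numLeavesAt G v → ∀ {f h} → Minimal (Dominating G) f → Minimal (Dominating H) h →
    weight f ≡ weight h
  attach-preserves-minimum {n} {m} G v H attach j 2≤leaves {f} {h} (f-dom , f-least) (h-dom , h-least)
    with two-leaves G v 2≤leaves
  ... | a , b , a≢b , pendant-a , pendant-b = ≤-antisym f≤h h≤f
    where
    open Attached G v H attach
    open ≤-Reasoning
    f′ : Fin n → ℕ
    f′ = concentrate G v k f
    h′ : Fin (n + m) → ℕ
    h′ = concentrate H (v ↑ˡ m) k h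
    f≤h : weight f ≤ weight h
    f≤h = begin
      weight f             ≤⟨ f-least (restrict h′) (restrict-isDominating G v H attach
                                (concentrate-isDominating H (v ↑ˡ m) h-dom)
                                (concentrate-centre H (v ↑ˡ m) k h)) ⟩
      weight (restrict h′) ≡⟨ weight-restrict h′ (λ i → concentrate-pendant H k h (new-pendant i)) ⟩
      weight h′            ≤⟨ concentrate-improves H (v ↑ˡ m) h-dom (↑ˡ≢↑ʳ a j)
                                (old-pendant pendant-a) (new-pendant j) ⟩
      weight h             ∎
    h≤f : weight h ≤ weight f
    h≤f = begin
      weight h             ≤⟨ h-least (extend f′) (extend-isDominating G v H attach
                                (concentrate-isDominating G v f-dom) (concentrate-centre G v k f)) ⟩
      weight (extend f′)   ≡⟨ weight-extend f′ ⟩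
      weight f′            ≤⟨ concentrate-improves G v f-dom a≢b pendant-a pendant-b ⟩
      weight f             ∎

lemma2p4 : (k n : ℕ) → 2 ≤ k → (G : Graph n) → Connected G → (v : Fin n)
  → 2 ≤ numLeavesAt G v
  → (Σ (Fin n → ℕ) (λ f → IsGammaFun G k f × f v ≡ k
        × (∀ u → adj G v u ≡ true → IsLeaf G u → f u ≡ 0))
     × Σ (Fin n → ℕ) (λ f → IsGammaSFun G k f × f v ≡ k
        × (∀ u → adj G v u ≡ true → IsLeaf G u → f u ≡ 0)))
    × ((m : ℕ) → 1 ≤ m → (H : Graph (n + m)) → AttachPendants m G v H
        → (∀ a b → IsGamma G k a → IsGamma H k b → a ≡ b)
        × (∀ a b → IsGammaS G k a → IsGammaS H k b → a ≡ b))
lemma2p4 k n 2≤k G _ v 2≤leaves =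
  ( map₂ (map₁ (from (roman G _))) (Roman.minimal-concentrated G v 2≤leaves)
  , map₂ (map₁ (from (strong G _))) (Strong.minimal-concentrated G v 2≤leaves) )
  , λ m 1≤m H attach →
      (λ { _ _ (f , f-minimal , refl) (h , h-minimal , refl) →
           Roman.attach-preserves-minimum G v H attach (fromℕ< 1≤m) 2≤leaves
             (to (roman G f) f-minimal) (to (roman H h) h-minimal) })
    , (λ { _ _ (f , f-minimal , refl) (h , h-minimal , refl) →
           Strong.attach-preserves-minimum G v H attach (fromℕ< 1≤m) 2≤leaves
             (to (strong G f) f-minimal) (to (strong H h) h-minimal) })
  where
  open Equivalence
  module Roman  = Domination (full k)
  module Strong = Domination (heavy (≤-trans (s≤s z≤n) 2≤k))
  roman : ∀ {n} (K : Graph n) f → IsGammaFun K k f ⇔ Minimal (Roman.Dominating K) f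
  roman K = Minimal-⇔ (IsRDF⇔IsDominating K k)
  strong : ∀ {n} (K : Graph n) f → IsGammaSFun K k f ⇔ Minimal (Strong.Dominating K) f
  strong K = Minimal-⇔ (IsSRDF⇔IsDominating K k)
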